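{- Let $U$ be a finite set, $\mu$ a closure operator on $2^U$ (identified with $\{(S,S\mu):S\subseteq U\}$), and let $\alpha,\beta\subseteq\mu$ be nonredundant covers of $\mu$. Then direct determination defines a self-inverse bijection between the elements of $\alpha$ and $\beta$: for each $(X,C)\in\alpha$ there is exactly one $(Y,C)\in\beta$ with $X\dot\rightarrow Y$, the resulting map $\alpha\to\beta$ is a bijection, and its inverse sends $(Y,C)\in\beta$ to the unique $(X,C)\in\alpha$ with $Y\dot\rightarrow X$.
   Context: A closure operator on $2^U$ is a map $\mu:2^U\to2^U$, $X\mapsto X\mu$, with $X\subseteq X\mu$, $X\subseteq Y\Rightarrow X\mu\subseteq Y\mu$, $X\mu\mu=X\mu$. Extension by closure: for a function $\alpha$ (a set of pairs $(S,T)$ of subsets of $U$, at most one pair per $S$) and $X\subseteq U$, put $X\alpha_0=X$, $X\alpha_{t+1}=X\alpha_t\cup\bigcup\{T:(S,T)\in\alpha,\ S\subseteq X\alpha_t\}$; the sequence stabilizes and $X\alpha^+$ is its final value; $\alpha^+$ is $X\mapsto X\alpha^+$. A subset $\alpha\subseteq\mu$ is a cover of $\mu$ if $\alpha^+=\mu$; a cover is nonredundant if no proper subset $\beta\subsetneq\alpha$ has $\beta^+=\alpha^+$. For a closed set $C$, $\mu_{\subset C}=\{(S,S\mu): S\subseteq U,\ S\mu\subsetneq C\}$. For $X,Y\subseteq U$, $X\dot\rightarrow Y$ ($X$ directly determines $Y$) means $X\mu=Y\mu=C$ and $Y\subseteq X(\mu_{\subset C})^+$. -}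

module Defs where

open import Data.Nat using (ℕ; zero; suc)
open import Data.Fin using (Fin)
open import Data.Fin.Subset using (Subset; _∈_; _⊆_; _⊂_)
open import Data.Maybe using (Maybe; just; nothing)
open import Data.Product using (Σ; ∃; ∃!; _×_; _,_)
open import Data.Sum using (_⊎_)
open import Relation.Binary.PropositionalEquality using (_≡_)
open import Relation.Nullary using (¬_)

-- The finite set U is Fin n; subsets of U are Data.Fin.Subset.Subset n.

record IsClosure {n : ℕ} (μ : Subset n → Subset n) : Set where
  field
    extensive  : ∀ X → X ⊆ μ X
    monotone   : ∀ X Y → X ⊆ Y → μ X ⊆ μ Y
    idempotent : ∀ X → μ (μ X) ≡ μ X

-- A "function" in the sense of the paper: a set of pairs (S , T) of subsets
-- of U with at most one pair per S, i.e. a partial map S ↦ T.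
Func : ℕ → Set
Func n = Subset n → Maybe (Subset n)

PairSet : ℕ → Set₁
PairSet n = Subset n → Subset n → Set

asPairs : ∀ {n} → Func n → PairSet n
asPairs α S T = α S ≡ just T

-- Extension by closure: membership in X α_t ...
iter : ∀ {n} → PairSet n → Subset n → ℕ → Fin n → Set
iter         R X zero    x = x ∈ X
iter {n = n} R X (suc t) x =
  iter R X t x ⊎ Σ (Subset n) λ S → Σ (Subset n) λ T →
    R S T × (∀ y → y ∈ S → iter R X t y) × x ∈ T
-- ... and X α^+ is the final (= union of all) value of the increasing sequence.
_∈ext_[_] : ∀ {n} → Fin n → PairSet n → Subset n → Set
x ∈ext R [ X ] = ∃ λ t → iter R X t x

ExtEq : ∀ {n} → PairSet n → (Subset n → Subset n) → Set
ExtEq R ν = ∀ X x → (x ∈ext R [ X ] → x ∈ ν X) × (x ∈ ν X → x ∈ext R [ X ])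

SameExt : ∀ {n} → PairSet n → PairSet n → Set
SameExt R Q = ∀ X x → (x ∈ext R [ X ] → x ∈ext Q [ X ]) × (x ∈ext Q [ X ] → x ∈ext R [ X ])

SubOf : ∀ {n} → Func n → (Subset n → Subset n) → Set
SubOf α μ = ∀ S T → α S ≡ just T → T ≡ μ S

IsCover : ∀ {n} → (Subset n → Subset n) → Func n → Set
IsCover μ α = SubOf α μ × ExtEq (asPairs α) μ

ProperSub : ∀ {n} → Func n → Func n → Set
ProperSub β α = (∀ S T → β S ≡ just T → α S ≡ just T)
              × (∃ λ S → ∃ λ T → α S ≡ just T × β S ≡ nothing)

Nonredundant : ∀ {n} → Func n → Set
Nonredundant {n} α = (β : Func n) → ProperSub β α → ¬ SameExt (asPairs β) (asPairs α)

μ⊂ : ∀ {n} → (Subset n → Subset n) → Subset n → PairSet n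
μ⊂ μ C S T = T ≡ μ S × μ S ⊂ C

DirDet : ∀ {n} → (Subset n → Subset n) → Subset n → Subset n → Set
DirDet μ X Y = μ X ≡ μ Y × (∀ y → y ∈ Y → y ∈ext μ⊂ μ (μ X) [ X ])

{-# OPTIONS --safe #-}
module Submission where

-- Let (X , C) ∈ α.  Deriving a closed set strictly below C never fires (X , C),
-- so X (μ_{⊂C})^+ survives the removal of (X , C) from α; by nonredundancy C
-- does not, hence C ⊄ X (μ_{⊂C})^+.  Following a β-derivation of C from X, the
-- first β-step that leaves X (μ_{⊂C})^+ has a premise Y with (Y , C) ∈ β and
-- X ⇒ Y (direct determination).  Direct determination is transitive, and by the
-- same nonredundancy argument X ⇒ X′ with (X′ , C) ∈ α forces X′ = X; composing
-- X ⇒ Y ⇒ X′ gives symmetry, and composing Y′ ⇒ X ⇒ Y in β gives uniqueness.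

open import Defs
open import Data.Nat using (ℕ; zero; suc; _+_)
open import Data.Nat.Properties using (+-comm)
open import Data.Bool using () renaming (_≟_ to _≟ᵇ_)
open import Data.Fin using (Fin) renaming (zero to fz; suc to fs)
open import Data.Fin.Properties using (¬∀⟶∃¬)
open import Data.Fin.Subset using (Subset; _∈_; _⊆_; _⊂_)
open import Data.Fin.Subset.Properties using (⊆-antisym; _∈?_)
open import Data.Vec.Properties using (≡-dec)
open import Data.Maybe using (just; nothing)
open import Data.Maybe.Properties using (just-injective)
open import Data.Product using (∃; ∃!; _×_; _,_; proj₁; proj₂)
open import Data.Sum using (_⊎_; inj₁; inj₂)
open import Relation.Nullary using (¬_; Dec; yes; no; contradiction)
open import Relation.Nullary.Decidable using (_→-dec_)
open import Relation.Binary.PropositionalEquality using (_≡_; refl; sym; trans; subst)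

_≟ₛ_ : ∀ {n} (p q : Subset n) → Dec (p ≡ q)
_≟ₛ_ = ≡-dec _≟ᵇ_

_⊆ₚ_ : ∀ {n} → Subset n → (Fin n → Set) → Set
S ⊆ₚ P = ∀ y → y ∈ S → P y

∀-⊎-pull : ∀ {n} {B : Set} (A : Fin n → Set) → (∀ y → A y ⊎ B) → (∀ y → A y) ⊎ B
∀-⊎-pull {zero}  A h = inj₁ λ ()
∀-⊎-pull {suc n} A h with h fz | ∀-⊎-pull (λ y → A (fs y)) (λ y → h (fs y))
... | inj₂ b | _      = inj₂ b
... | inj₁ _ | inj₂ b = inj₂ b
... | inj₁ a | inj₁ f = inj₁ λ { fz → a ; (fs y) → f y }

⊆ₚ-⊎-pull : ∀ {n} {B : Set} (S : Subset n) (A : Fin n → Set) →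
            S ⊆ₚ (λ y → A y ⊎ B) → S ⊆ₚ A ⊎ B
⊆ₚ-⊎-pull S A h = ∀-⊎-pull (λ y → y ∈ S → A y) decide
  where
    decide : ∀ y → (y ∈ S → A y) ⊎ _
    decide y with y ∈? S
    ... | no  y∉S = inj₁ λ y∈S → contradiction y∈S y∉S
    ... | yes y∈S with h y y∈S
    ...   | inj₁ a = inj₁ λ _ → a
    ...   | inj₂ b = inj₂ b

raise : ∀ (P : ℕ → Set) → (∀ {t} → P t → P (suc t)) → ∀ k {t} → P t → P (k + t)
raise P up zero    p = p
raise P up (suc k) p = up (raise P up k p)

common-stage : ∀ {n} (P : Fin n → ℕ → Set) → (∀ {y t} → P y t → P y (suc t)) →
               (∀ y → ∃ (P y)) → ∃ λ t → ∀ y → P y t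
common-stage {zero}  P up h = 0 , λ ()
common-stage {suc n} P up h with h fz | common-stage (λ y → P (fs y)) up (λ y → h (fs y))
... | t₀ , p₀ | t , f = t + t₀ , λ
  { fz     → raise (P fz) up t p₀
  ; (fs y) → subst (P (fs y)) (+-comm t₀ t) (raise (P (fs y)) up t₀ (f y)) }

⊆∧≢⇒⊂ : ∀ {n} {p q : Subset n} → p ⊆ q → ¬ p ≡ q → p ⊂ q
⊆∧≢⇒⊂ {n} {p} {q} p⊆q p≢q with ¬∀⟶∃¬ n _ (λ x → x ∈? q →-dec x ∈? p)
                                      (λ q⊆p → p≢q (⊆-antisym p⊆q (q⊆p _)))
... | x , ¬q⊆p with x ∈? q
...   | yes x∈q = p⊆q , x , x∈q , λ x∈p → ¬q⊆p λ _ → x∈p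
...   | no  x∉q = contradiction (λ x∈q → contradiction x∈q x∉q) ¬q⊆p

module Extension {n : ℕ} (R : PairSet n) where

  ∈ext-base : ∀ {X x} → x ∈ X → x ∈ext R [ X ]
  ∈ext-base x∈X = 0 , x∈X

  ∈ext-step : ∀ {X S T} → R S T → S ⊆ₚ (_∈ext R [ X ]) → T ⊆ₚ (_∈ext R [ X ])
  ∈ext-step {X} {S} {T} r h x x∈T
    with common-stage (λ y t → y ∈ S → iter R X t y) (λ p m → inj₁ (p m)) stage
    where
      stage : ∀ y → ∃ λ t → y ∈ S → iter R X t y
      stage y with y ∈? S
      ... | yes y∈S = proj₁ (h y y∈S) , λ _ → proj₂ (h y y∈S)
      ... | no  y∉S = 0 , λ y∈S → contradiction y∈S y∉S
  ... | t , S-reached = suc t , inj₂ (S , T , r , S-reached , x∈T)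

  ∈ext-ind : ∀ X (Q : Fin n → Set) → X ⊆ₚ Q →
             (∀ {S T} → R S T → S ⊆ₚ Q → T ⊆ₚ Q) → ∀ x → x ∈ext R [ X ] → Q x
  ∈ext-ind X Q base step x (t , p) = go t x p
    where
      go : ∀ t x → iter R X t x → Q x
      go zero    x p                               = base x p
      go (suc t) x (inj₁ p)                        = go t x p
      go (suc t) x (inj₂ (S , T , r , S-in , x∈T)) = step r (λ y y∈S → go t y (S-in y y∈S)) x x∈T

  ∈ext-trans : ∀ {X Y} → Y ⊆ₚ (_∈ext R [ X ]) → ∀ x → x ∈ext R [ Y ] → x ∈ext R [ X ]
  ∈ext-trans {Y = Y} h = ∈ext-ind Y _ h ∈ext-step

open Extension

∈ext-mono : ∀ {n} {R Q : PairSet n} → (∀ {S T} → R S T → Q S T) →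
            ∀ X x → x ∈ext R [ X ] → x ∈ext Q [ X ]
∈ext-mono {R = R} {Q} R⊆Q X = ∈ext-ind R X _ (λ _ → ∈ext-base Q) (λ r → ∈ext-step Q (R⊆Q r))

_without_ : ∀ {n} → Func n → Subset n → Func n
(α without X) S with S ≟ₛ X
... | yes _ = nothing
... | no  _ = α S

module _ {n : ℕ} {α : Func n} {X : Subset n} where

  without-removes : (α without X) X ≡ nothing
  without-removes with X ≟ₛ X
  ... | yes _   = refl
  ... | no  X≢X = contradiction refl X≢X

  without-keeps : ∀ {S} → ¬ S ≡ X → (α without X) S ≡ α S
  without-keeps {S} S≢X with S ≟ₛ X
  ... | yes S≡X = contradiction S≡X S≢X
  ... | no  _   = refl

  without-⊆ : ∀ {S T} → (α without X) S ≡ just T → α S ≡ just T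
  without-⊆ {S} e with S ≟ₛ X
  ... | no _ = e

  without-⊂ : ∀ {C} → α X ≡ just C → ProperSub (α without X) α
  without-⊂ {C} αX = (λ _ _ → without-⊆) , X , C , αX , without-removes

  without-sameExt : ∀ {C} → α X ≡ just C → C ⊆ₚ (_∈ext asPairs (α without X) [ X ]) →
                    SameExt (asPairs (α without X)) (asPairs α)
  without-sameExt {C} αX C-derived W x =
    ∈ext-mono without-⊆ W x , ∈ext-ind (asPairs α) W _ (λ _ → ∈ext-base α′) step x
    where
      α′ = asPairs (α without X)
      step : ∀ {S T} → α S ≡ just T → S ⊆ₚ (_∈ext α′ [ W ]) → T ⊆ₚ (_∈ext α′ [ W ])
      step {S} αS S-in y y∈T with S ≟ₛ X
      ... | yes refl =
        ∈ext-trans α′ S-in y (C-derived y (subst (y ∈_) (just-injective (trans (sym αS) αX)) y∈T))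
      ... | no  S≢X  = ∈ext-step α′ (trans (without-keeps S≢X) αS) S-in y y∈T

  premise-needed : Nonredundant α → ∀ {C} → α X ≡ just C →
                   ¬ C ⊆ₚ (_∈ext asPairs (α without X) [ X ])
  premise-needed nr αX C-derived = nr _ (without-⊂ αX) (without-sameExt αX C-derived)

module _ {n : ℕ} {μ : Subset n → Subset n} (cl : IsClosure μ) where
  open IsClosure cl

  μ-absorb : ∀ {A B} → A ⊆ μ B → μ A ⊆ μ B
  μ-absorb {A} {B} A⊆μB x∈μA = subst (_ ∈_) (idempotent B) (monotone A (μ B) A⊆μB x∈μA)

  ⟨_⟩⁺ : Subset n → Fin n → Set
  ⟨ X ⟩⁺ x = x ∈ext μ⊂ μ (μ X) [ X ]

  ⟨⟩⁺⊆μ : ∀ X x → ⟨ X ⟩⁺ x → x ∈ μ X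
  ⟨⟩⁺⊆μ X = ∈ext-ind _ X _ (λ _ → extensive X) (λ { (refl , μS⊂μX) _ x x∈μS → proj₁ μS⊂μX x∈μS })

  DirDet-trans : ∀ {X Y W} → DirDet μ X Y → DirDet μ Y W → DirDet μ X W
  DirDet-trans {X} {Y} (μX≡μY , Y⊆X⁺) (μY≡μW , W⊆Y⁺) =
    trans μX≡μY μY≡μW ,
    λ w w∈W → ∈ext-trans _ Y⊆X⁺ w (subst (λ D → w ∈ext μ⊂ μ D [ Y ]) (sym μX≡μY) (W⊆Y⁺ w w∈W))

  ⟨⟩⁺-closed-below : ∀ {X S} → S ⊆ₚ ⟨ X ⟩⁺ → ¬ μ S ≡ μ X → μ S ⊆ₚ ⟨ X ⟩⁺
  ⟨⟩⁺-closed-below {X} {S} S⊆X⁺ μS≢μX = ∈ext-step _ (refl , ⊆∧≢⇒⊂ μS⊆μX μS≢μX) S⊆X⁺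
    where
      μS⊆μX : μ S ⊆ μ X
      μS⊆μX = μ-absorb λ {y} y∈S → ⟨⟩⁺⊆μ X y (S⊆X⁺ y y∈S)

  module _ {α : Func n} (cov : IsCover μ α) where

    -- A derivation of μ S from S by α never fires a pair (X , _): that would need X ⊆ μ S.
    smaller-closure-avoids : ∀ {S X} → μ S ⊂ μ X → μ S ⊆ₚ (_∈ext asPairs (α without X) [ S ])
    smaller-closure-avoids {S} {X} (μS⊆μX , x , x∈μX , x∉μS) y y∈μS =
      proj₁ (∈ext-ind (asPairs α) S Q (λ y y∈S → ∈ext-base α′ y∈S , extensive S y∈S) step y
                      (proj₂ (proj₂ cov S y) y∈μS))
      where
        α′ = asPairs (α without X)
        Q : Fin n → Set
        Q y = y ∈ext α′ [ S ] × y ∈ μ S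
        step : ∀ {S′ T′} → α S′ ≡ just T′ → S′ ⊆ₚ Q → T′ ⊆ₚ Q
        step {S′} αS′ S′⊆Q z z∈T′ with S′ ≟ₛ X
        ... | yes refl = contradiction (μ-absorb (λ {y} y∈X → proj₂ (S′⊆Q y y∈X)) x∈μX) x∉μS
        ... | no  S′≢X =
          ∈ext-step α′ (trans (without-keeps S′≢X) αS′) (λ y y∈S′ → proj₁ (S′⊆Q y y∈S′)) z z∈T′ ,
          μ-absorb (λ {y} y∈S′ → proj₂ (S′⊆Q y y∈S′)) (subst (z ∈_) (proj₁ cov S′ _ αS′) z∈T′)

    ⟨⟩⁺-avoids : ∀ X x → ⟨ X ⟩⁺ x → x ∈ext asPairs (α without X) [ X ]
    ⟨⟩⁺-avoids X = ∈ext-ind _ X _ (λ _ → ∈ext-base _)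
      λ { (refl , μS⊂μX) S-in x x∈μS → ∈ext-trans _ S-in x (smaller-closure-avoids μS⊂μX x x∈μS) }

    premise-unique : Nonredundant α → ∀ {X X′ C} → α X ≡ just C → α X′ ≡ just C →
                     DirDet μ X X′ → X′ ≡ X
    premise-unique nr {X} {X′} αX αX′ (_ , X′⊆X⁺) with X′ ≟ₛ X
    ... | yes X′≡X = X′≡X
    ... | no  X′≢X = contradiction
      (∈ext-step _ (trans (without-keeps X′≢X) αX′) λ y y∈X′ → ⟨⟩⁺-avoids X y (X′⊆X⁺ y y∈X′))
      (premise-needed nr αX)

  derivation-dichotomy : ∀ {β : Func n} → SubOf β μ → ∀ X x → x ∈ext asPairs β [ X ] →
                         ⟨ X ⟩⁺ x ⊎ ∃ λ Y → β Y ≡ just (μ X) × Y ⊆ₚ ⟨ X ⟩⁺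
  derivation-dichotomy {β} β⊆μ X = ∈ext-ind _ X _ (λ _ x∈X → inj₁ (∈ext-base _ x∈X)) step
    where
      step : ∀ {S T} → β S ≡ just T → S ⊆ₚ (λ y → ⟨ X ⟩⁺ y ⊎ _) → T ⊆ₚ (λ y → ⟨ X ⟩⁺ y ⊎ _)
      step {S} {T} βS S-in x x∈T with ⊆ₚ-⊎-pull S ⟨ X ⟩⁺ S-in | β⊆μ S T βS
      ... | inj₂ escape | _    = inj₂ escape
      ... | inj₁ S⊆X⁺   | refl with μ S ≟ₛ μ X
      ...   | yes μS≡μX = inj₂ (S , subst (λ D → β S ≡ just D) μS≡μX βS , S⊆X⁺)
      ...   | no  μS≢μX = inj₁ (⟨⟩⁺-closed-below S⊆X⁺ μS≢μX x x∈T)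

  determined-premise-exists : ∀ {α β} → IsCover μ α → Nonredundant α → IsCover μ β →
                              ∀ {X C} → α X ≡ just C → ∃ λ Y → β Y ≡ just C × DirDet μ X Y
  determined-premise-exists cα nα (β⊆μ , β⁺≡μ) {X} {C} αX with proj₁ cα X C αX
  ... | refl with ⊆ₚ-⊎-pull (μ X) ⟨ X ⟩⁺ (λ x x∈μX →
                    derivation-dichotomy β⊆μ X x (proj₂ (β⁺≡μ X x) x∈μX))
  ...   | inj₂ (Y , βY , Y⊆X⁺) = Y , βY , β⊆μ Y (μ X) βY , Y⊆X⁺
  ...   | inj₁ μX⊆X⁺ =
    contradiction (λ x x∈μX → ⟨⟩⁺-avoids cα X x (μX⊆X⁺ x x∈μX)) (premise-needed nα αX)

  module _ {α β : Func n} (cα : IsCover μ α) (nα : Nonredundant α)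
                          (cβ : IsCover μ β) (nβ : Nonredundant β) where

    DirDet-sym : ∀ {X Y C} → α X ≡ just C → β Y ≡ just C → DirDet μ X Y → DirDet μ Y X
    DirDet-sym αX βY X→Y with determined-premise-exists cβ nβ cα βY
    ... | X′ , αX′ , Y→X′ with premise-unique cα nα αX αX′ (DirDet-trans X→Y Y→X′)
    ...   | refl = Y→X′

    determined-premise-unique : ∀ {X C} → α X ≡ just C →
                                ∃! _≡_ (λ Y → β Y ≡ just C × DirDet μ X Y)
    determined-premise-unique αX with determined-premise-exists cα nα cβ αX
    ... | Y , βY , X→Y = Y , (βY , X→Y) , λ (βY′ , X→Y′) →
      sym (premise-unique cβ nβ βY βY′ (DirDet-trans (DirDet-sym αX βY X→Y) X→Y′))

mainTheorem15 : (n : ℕ) (μ : Subset n → Subset n) → IsClosure μ →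
    (α β : Func n) → IsCover μ α → Nonredundant α → IsCover μ β → Nonredundant β →
    -- each (X , C) ∈ α directly determines exactly one (Y , C) ∈ β
    (∀ X C → α X ≡ just C → ∃! _≡_ (λ Y → β Y ≡ just C × DirDet μ X Y))
    -- each (Y , C) ∈ β directly determines exactly one (X , C) ∈ α
    × (∀ Y C → β Y ≡ just C → ∃! _≡_ (λ X → α X ≡ just C × DirDet μ Y X))
    -- the two maps are mutually inverse (so the map α → β is a bijection
    -- whose inverse is given by direct determination from β)
    × (∀ X Y C → α X ≡ just C → β Y ≡ just C → DirDet μ X Y → DirDet μ Y X)
    × (∀ X Y C → α X ≡ just C → β Y ≡ just C → DirDet μ Y X → DirDet μ X Y)
mainTheorem15 n μ cl α β cα nα cβ nβ =
    (λ _ _ → determined-premise-unique cl cα nα cβ nβ)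
  , (λ _ _ → determined-premise-unique cl cβ nβ cα nα)
  , (λ _ _ _ → DirDet-sym cl cα nα cβ nβ)
  , (λ _ _ _ αX βY → DirDet-sym cl cβ nβ cα nα βY αX)
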